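{- Let $N = q^k n^2$ be an odd perfect number, where $q$ is a prime with $q \equiv k \equiv 1 \pmod 4$ and $\gcd(q,n)=1$. Then $$\gcd\left(n^2, \sigma(n^2)\right) = \frac{D(n^2)}{\sigma(q^{k-1})} = \frac{\sigma(N/q^k)}{q^k}.$$
   Context: For a positive integer $N$, $\sigma(N)$ denotes the sum of the positive divisors of $N$; $N$ is perfect if $\sigma(N)=2N$. The deficiency of a positive integer $x$ is $D(x) = 2x - \sigma(x)$. -}

module Defs where

open import Data.Nat using (ℕ; suc; _*_; _%_)
open import Data.Nat.Divisibility using (_∣?_)
open import Data.List using (List; filter; map; upTo)
open import Data.Nat.ListAction using (sum)
open import Data.Integer using (ℤ; +_; _-_)
open import Relation.Binary.PropositionalEquality using (_≡_)

divisors : ℕ → List ℕ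
divisors N = filter (_∣? N) (map suc (upTo N))

σ : ℕ → ℕ
σ N = sum (divisors N)

Perfect : ℕ → Set
Perfect N = σ N ≡ 2 * N

-- deficiency D(x) = 2x - σ(x), as an integer (it may be negative in general)
D : ℕ → ℤ
D x = + (2 * x) - + (σ x)

Odd : ℕ → Set
Odd N = N % 2 ≡ 1

-- Write M = n². Since q ∤ M, σ(q^k M) = σ(q^k) σ(M), so perfection reads
-- σ(q^k) σ(M) = 2 q^k M. As σ(q^k) ≡ 1 (mod q), q^k divides σ(M); put σ(M) = m q^k,
-- so that σ(q^k) m = 2M. Because q and k are odd, σ(q^k) = 1 + q + ⋯ + q^k is even,
-- hence m ∣ M, and since q^k is coprime to M we get gcd(M, σ(M)) = m. This gives
-- the second identity, and the first is 2M = m σ(q^k) = σ(M) + m σ(q^(k-1)).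

module Submission where

open import Defs
open import Data.Nat using (ℕ; _*_; _^_; _∸_; _%_; _/_; _>_; NonZero)
open import Data.Nat.GCD using (gcd)
open import Data.Nat.Primality using (Prime)
open import Data.Integer using (+_) renaming (_*_ to _*ℤ_)
open import Data.Product using (_×_)
open import Relation.Binary.PropositionalEquality using (_≡_)

open import Data.Nat using (zero; suc; _+_; _≤_; _<_; s≤s; z<s; s<s; >-nonZero)
open import Data.Nat.Properties
open import Data.Nat.Divisibility
open import Data.Nat.Coprimality using (Coprime; coprime-divisor; gcd≡1⇒coprime) renaming (sym to coprime-sym)
open import Data.Nat.Primality using (prime⇒irreducible; prime⇒nonZero; ¬prime[1])
open import Data.Nat.GCD using (gcd-greatest; gcd[m,n]∣m; gcd[m,n]∣n)
open import Data.Nat.DivMod using (m≡m%n+[m/n]*n; m*n/n≡m)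
open import Data.Nat.ListAction using (sum)
open import Data.Nat.ListAction.Properties using (sum-++)
open import Data.Nat.Tactic.RingSolver using (solve-∀)
open import Data.List using ([]; _∷_; _++_; filter; map; applyUpTo)
open import Data.List.Properties using (map-applyUpTo; applyUpTo-∷ʳ)
open import Data.Bool using (if_then_else_)
open import Data.Product using (_,_)
open import Data.Sum using (inj₁; inj₂)
open import Function using (_∘_; id)
open import Relation.Nullary using (¬_; yes; no; does; contradiction)
open import Relation.Unary using (Decidable)
open import Relation.Binary.PropositionalEquality using (refl; sym; trans; cong; cong₂; subst; module ≡-Reasoning)
open import Algebra.Properties.CommutativeSemigroup +-commutativeSemigroup using (interchange)
import Data.Integer as ℤ
import Data.Integer.Properties as ℤ

open ≡-Reasoning

∑ : ℕ → (ℕ → ℕ) → ℕ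
∑ n f = sum (applyUpTo f n)

∑-cong : ∀ n {f g} → (∀ {i} → i < n → f i ≡ g i) → ∑ n f ≡ ∑ n g
∑-cong zero    eq = refl
∑-cong (suc n) eq = cong₂ _+_ (eq z<s) (∑-cong n (eq ∘ s<s))

∑-zero : ∀ n {f} → (∀ {i} → i < n → f i ≡ 0) → ∑ n f ≡ 0
∑-zero zero    eq = refl
∑-zero (suc n) eq = cong₂ _+_ (eq z<s) (∑-zero n (eq ∘ s<s))

∑-++ : ∀ m n f → ∑ (m + n) f ≡ ∑ m f + ∑ n (λ i → f (m + i))
∑-++ zero    n f = refl
∑-++ (suc m) n f = trans (cong (λ s → f 0 + s) (∑-++ m n (f ∘ suc))) (sym (+-assoc (f 0) _ _))

∑-last : ∀ n f → ∑ (suc n) f ≡ ∑ n f + f n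
∑-last n f = begin
  sum (applyUpTo f (suc n))         ≡⟨ cong sum (applyUpTo-∷ʳ f n) ⟨
  sum (applyUpTo f n ++ f n ∷ [])   ≡⟨ sum-++ (applyUpTo f n) (f n ∷ []) ⟩
  ∑ n f + (f n + 0)                 ≡⟨ cong (λ s → ∑ n f + s) (+-identityʳ (f n)) ⟩
  ∑ n f + f n                       ∎

∑-distrib-+ : ∀ n f g → ∑ n (λ i → f i + g i) ≡ ∑ n f + ∑ n g
∑-distrib-+ zero    f g = refl
∑-distrib-+ (suc n) f g = trans (cong (λ s → f 0 + g 0 + s) (∑-distrib-+ n (f ∘ suc) (g ∘ suc)))
                                (interchange (f 0) (g 0) _ _)

∑-distribˡ-* : ∀ n c f → ∑ n (λ i → c * f i) ≡ c * ∑ n f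
∑-distribˡ-* zero    c f = sym (*-zeroʳ c)
∑-distribˡ-* (suc n) c f = trans (cong (λ s → c * f 0 + s) (∑-distribˡ-* n c (f ∘ suc)))
                                 (sym (*-distribˡ-+ c (f 0) _))

select : {P : ℕ → Set} → Decidable P → (ℕ → ℕ) → ℕ → ℕ
select P? f x = if does (P? x) then f x else 0

module _ {P : ℕ → Set} (P? : Decidable P) (f : ℕ → ℕ) {x : ℕ} where

  select-yes : P x → select P? f x ≡ f x
  select-yes px with P? x
  ... | yes _   = refl
  ... | no ¬px  = contradiction px ¬px

  select-no : ¬ P x → select P? f x ≡ 0
  select-no ¬px with P? x
  ... | yes px = contradiction px ¬px
  ... | no _   = refl

select-⇔ : ∀ {P Q : ℕ → Set} (P? : Decidable P) (Q? : Decidable Q) f {x} →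
  (P x → Q x) → (Q x → P x) → select P? f x ≡ select Q? f x
select-⇔ P? Q? f {x} P⇒Q Q⇒P with Q? x
... | yes qx  = select-yes P? f (Q⇒P qx)
... | no  ¬qx = select-no P? f (¬qx ∘ P⇒Q)

sum-filter : ∀ {P : ℕ → Set} (P? : Decidable P) xs → sum (filter P? xs) ≡ sum (map (select P? id) xs)
sum-filter P? []       = refl
sum-filter P? (x ∷ xs) with P? x
... | yes _ = cong (λ s → x + s) (sum-filter P? xs)
... | no _  = sum-filter P? xs

divisorTerm : ℕ → ℕ → ℕ
divisorTerm N = select (_∣? N) id

σ≡∑ : ∀ N → σ N ≡ ∑ N (divisorTerm N ∘ suc)
σ≡∑ N = begin
  sum (filter (_∣? N) (map suc (applyUpTo id N)))      ≡⟨ sum-filter (_∣? N) (map suc (applyUpTo id N)) ⟩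
  sum (map (divisorTerm N) (map suc (applyUpTo id N))) ≡⟨ cong (sum ∘ map (divisorTerm N)) (map-applyUpTo id suc N) ⟩
  sum (map (divisorTerm N) (applyUpTo suc N))          ≡⟨ cong sum (map-applyUpTo suc (divisorTerm N) N) ⟩
  ∑ N (divisorTerm N ∘ suc)                            ∎

σ≡∑-beyond : ∀ M .{{_ : NonZero M}} K → M ≤ K → σ M ≡ ∑ K (divisorTerm M ∘ suc)
σ≡∑-beyond M K M≤K = begin
  σ M                                                     ≡⟨ σ≡∑ M ⟩
  ∑ M (divisorTerm M ∘ suc)                               ≡⟨ +-identityʳ _ ⟨
  ∑ M (divisorTerm M ∘ suc) + 0                           ≡⟨ cong (λ s → ∑ M (divisorTerm M ∘ suc) + s) tail≡0 ⟨
  ∑ M (divisorTerm M ∘ suc) + ∑ (K ∸ M) (λ i → divisorTerm M (suc (M + i)))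
                                                          ≡⟨ ∑-++ M (K ∸ M) _ ⟨
  ∑ (M + (K ∸ M)) (divisorTerm M ∘ suc)                   ≡⟨ cong (λ n → ∑ n (divisorTerm M ∘ suc)) (m+[n∸m]≡n M≤K) ⟩
  ∑ K (divisorTerm M ∘ suc)                               ∎
  where
  tail≡0 : ∑ (K ∸ M) (λ i → divisorTerm M (suc (M + i))) ≡ 0
  tail≡0 = ∑-zero (K ∸ M) λ {i} _ → select-no (_∣? M) id (>⇒∤ (s≤s (m≤m+n M i)))

select-∣-+ : ∀ q h d → select (q ∣?_) h (q + d) ≡ select (q ∣?_) (λ x → h (q + x)) d
select-∣-+ q h d with q ∣? d
... | yes q∣d = select-yes (q ∣?_) h (∣m∣n⇒∣m+n ∣-refl q∣d)
... | no  q∤d = select-no (q ∣?_) h (λ q∣q+d → q∤d (∣m+n∣m⇒∣n q∣q+d ∣-refl))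

∑-multiples : ∀ q .{{_ : NonZero q}} X h →
  ∑ (X * q) (select (q ∣?_) h ∘ suc) ≡ ∑ X (λ u → h (suc u * q))
∑-multiples q         zero    h = refl
∑-multiples q@(suc p) (suc X) h = begin
  ∑ (q + X * q) (select (q ∣?_) h ∘ suc)
    ≡⟨ ∑-++ q (X * q) (select (q ∣?_) h ∘ suc) ⟩
  ∑ q (select (q ∣?_) h ∘ suc) + ∑ (X * q) (λ i → select (q ∣?_) h (suc (q + i)))
    ≡⟨ cong₂ _+_ first-block (∑-cong (X * q) λ {i} _ → shift i) ⟩
  h q + ∑ (X * q) (select (q ∣?_) (λ x → h (q + x)) ∘ suc)
    ≡⟨ cong₂ _+_ (cong h (sym (+-identityʳ q))) (∑-multiples q X (λ x → h (q + x))) ⟩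
  h (1 * q) + ∑ X (λ u → h (q + suc u * q))
    ∎
  where
  first-block : ∑ q (select (q ∣?_) h ∘ suc) ≡ h q
  first-block = begin
    ∑ (suc p) (select (q ∣?_) h ∘ suc)                     ≡⟨ ∑-last p (select (q ∣?_) h ∘ suc) ⟩
    ∑ p (select (q ∣?_) h ∘ suc) + select (q ∣?_) h q      ≡⟨ cong₂ _+_ below-q (select-yes (q ∣?_) h ∣-refl) ⟩
    h q                                                    ∎
    where
    below-q : ∑ p (select (q ∣?_) h ∘ suc) ≡ 0
    below-q = ∑-zero p λ i<p → select-no (q ∣?_) h (>⇒∤ (s<s i<p))
  shift : ∀ i → select (q ∣?_) h (suc (q + i)) ≡ select (q ∣?_) (λ x → h (q + x)) (suc i)
  shift i = trans (cong (select (q ∣?_) h) (sym (+-suc q i))) (select-∣-+ q h (suc i))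

divisorTerm-* : ∀ q .{{_ : NonZero q}} X d → divisorTerm (q * X) (d * q) ≡ q * divisorTerm X d
divisorTerm-* q X d with d ∣? X
... | yes d∣X = trans (select-yes (_∣? q * X) id (subst (_∣ q * X) (*-comm q d) (*-monoʳ-∣ q d∣X)))
                      (*-comm d q)
... | no  d∤X = trans (select-no (_∣? q * X) id (d∤X ∘ *-cancelˡ-∣ q ∘ subst (_∣ q * X) (*-comm d q)))
                      (sym (*-zeroʳ q))

coprime-^ʳ : ∀ {m n} e → Coprime m n → Coprime m (n ^ e)
coprime-^ʳ zero    m⊥n (_ , i∣1) = ∣1⇒≡1 i∣1
coprime-^ʳ (suc e) m⊥n (i∣m , i∣n*n^e) =
  coprime-^ʳ e m⊥n (i∣m , coprime-divisor (λ (j∣i , j∣n) → m⊥n (∣-trans j∣i i∣m , j∣n)) i∣n*n^e)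

module _ {q : ℕ} (q-prime : Prime q) where

  private instance
    q≢0 : NonZero q
    q≢0 = prime⇒nonZero q-prime

  q∤1 : q ∤ 1
  q∤1 q∣1 = ¬prime[1] (subst Prime (∣1⇒≡1 q∣1) q-prime)

  coprime⇒∤ : ∀ {m} → Coprime q m → q ∤ m
  coprime⇒∤ q⊥m q∣m = q∤1 (subst (q ∣_) (q⊥m (∣-refl , q∣m)) ∣-refl)

  ∤⇒coprime : ∀ {d} → q ∤ d → Coprime d q
  ∤⇒coprime q∤d (c∣d , c∣q) with prime⇒irreducible q-prime c∣q
  ... | inj₁ c≡1 = c≡1
  ... | inj₂ c≡q = contradiction (subst (_∣ _) c≡q c∣d) q∤d

  ∣q^e*n∧q∤⇒∣n : ∀ e {d n} → q ∤ d → d ∣ q ^ e * n → d ∣ n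
  ∣q^e*n∧q∤⇒∣n e q∤d = coprime-divisor (coprime-^ʳ e (∤⇒coprime q∤d))

  q^e∣m*n∧q∤m⇒q^e∣n : ∀ e {m n} → q ∤ m → q ^ e ∣ m * n → q ^ e ∣ n
  q^e∣m*n∧q∤m⇒q^e∣n e q∤m = coprime-divisor (coprime-sym (coprime-^ʳ e (∤⇒coprime q∤m)))

  module _ {M : ℕ} .{{_ : NonZero M}} (q∤M : q ∤ M) where

    divisorTerm-split : ∀ j d → divisorTerm (q * (q ^ j * M)) d
                              ≡ divisorTerm M d + select (q ∣?_) (divisorTerm (q * (q ^ j * M))) d
    divisorTerm-split j d with q ∣? d
    ... | yes q∣d = cong (_+ divisorTerm (q * (q ^ j * M)) d)
                         (sym (select-no (_∣? M) id (q∤M ∘ ∣-trans q∣d)))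
    ... | no  q∤d = trans (select-⇔ (_∣? q * (q ^ j * M)) (_∣? M) id from-q^[1+j]M to-q^[1+j]M)
                          (sym (+-identityʳ (divisorTerm M d)))
      where
      from-q^[1+j]M : d ∣ q * (q ^ j * M) → d ∣ M
      from-q^[1+j]M = ∣q^e*n∧q∤⇒∣n j q∤d ∘ coprime-divisor (∤⇒coprime q∤d)
      to-q^[1+j]M : d ∣ M → d ∣ q * (q ^ j * M)
      to-q^[1+j]M d∣M = ∣-trans d∣M (∣-trans (n∣m*n (q ^ j)) (n∣m*n q))

    -- A divisor of q^(j+1) M is either prime to q, and then divides M,
    -- or q times a divisor of q^j M.
    σ[q*q^j*M]≡σ[M]+q*σ[q^j*M] : ∀ j → σ (q * (q ^ j * M)) ≡ σ M + q * σ (q ^ j * M)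
    σ[q*q^j*M]≡σ[M]+q*σ[q^j*M] j = begin
      σ (q * X)
        ≡⟨ σ≡∑ (q * X) ⟩
      ∑ (q * X) (divisorTerm (q * X) ∘ suc)
        ≡⟨ ∑-cong (q * X) (λ {i} _ → divisorTerm-split j (suc i)) ⟩
      ∑ (q * X) (λ i → divisorTerm M (suc i) + select (q ∣?_) (divisorTerm (q * X)) (suc i))
        ≡⟨ ∑-distrib-+ (q * X) (divisorTerm M ∘ suc) (select (q ∣?_) (divisorTerm (q * X)) ∘ suc) ⟩
      ∑ (q * X) (divisorTerm M ∘ suc) + ∑ (q * X) (select (q ∣?_) (divisorTerm (q * X)) ∘ suc)
        ≡⟨ cong₂ _+_ (sym (σ≡∑-beyond M (q * X) M≤qX)) multiples ⟩
      σ M + q * σ X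
        ∎
      where
      X = q ^ j * M
      instance
        q^j≢0 : NonZero (q ^ j)
        q^j≢0 = m^n≢0 q j
      M≤qX : M ≤ q * X
      M≤qX = m≤n⇒m≤o*n q (m≤n*m M (q ^ j))
      multiples : ∑ (q * X) (select (q ∣?_) (divisorTerm (q * X)) ∘ suc) ≡ q * σ X
      multiples = begin
        ∑ (q * X) (select (q ∣?_) (divisorTerm (q * X)) ∘ suc)
          ≡⟨ cong (λ n → ∑ n (select (q ∣?_) (divisorTerm (q * X)) ∘ suc)) (*-comm q X) ⟩
        ∑ (X * q) (select (q ∣?_) (divisorTerm (q * X)) ∘ suc)
          ≡⟨ ∑-multiples q X (divisorTerm (q * X)) ⟩
        ∑ X (λ u → divisorTerm (q * X) (suc u * q))
          ≡⟨ ∑-cong X (λ {u} _ → divisorTerm-* q X (suc u)) ⟩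
        ∑ X (λ u → q * divisorTerm X (suc u))
          ≡⟨ ∑-distribˡ-* X q (divisorTerm X ∘ suc) ⟩
        q * ∑ X (divisorTerm X ∘ suc)
          ≡⟨ cong (q *_) (σ≡∑ X) ⟨
        q * σ X
          ∎

  σ[q^1+j] : ∀ j → σ (q ^ suc j) ≡ 1 + q * σ (q ^ j)
  σ[q^1+j] j = begin
    σ (q * q ^ j)            ≡⟨ cong (λ x → σ (q * x)) (*-identityʳ (q ^ j)) ⟨
    σ (q * (q ^ j * 1))      ≡⟨ σ[q*q^j*M]≡σ[M]+q*σ[q^j*M] q∤1 j ⟩
    1 + q * σ (q ^ j * 1)    ≡⟨ cong (λ x → 1 + q * σ x) (*-identityʳ (q ^ j)) ⟩
    1 + q * σ (q ^ j)        ∎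

  σ[q^1+j]≡q^1+j+σ[q^j] : ∀ j → σ (q ^ suc j) ≡ q ^ suc j + σ (q ^ j)
  σ[q^1+j]≡q^1+j+σ[q^j] zero    = trans (σ[q^1+j] 0) (+-comm 1 (q * 1))
  σ[q^1+j]≡q^1+j+σ[q^j] (suc j) = begin
    σ (q ^ suc (suc j))                          ≡⟨ σ[q^1+j] (suc j) ⟩
    1 + q * σ (q ^ suc j)                        ≡⟨ cong (λ x → 1 + q * x) (σ[q^1+j]≡q^1+j+σ[q^j] j) ⟩
    1 + q * (q ^ suc j + σ (q ^ j))              ≡⟨ regroup q (q ^ suc j) (σ (q ^ j)) ⟩
    q * q ^ suc j + (1 + q * σ (q ^ j))          ≡⟨ cong (λ x → q * q ^ suc j + x) (σ[q^1+j] j) ⟨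
    q ^ suc (suc j) + σ (q ^ suc j)              ∎
    where
    regroup : ∀ a b c → 1 + a * (b + c) ≡ a * b + (1 + a * c)
    regroup = solve-∀

  q∤σ[q^j] : ∀ j → q ∤ σ (q ^ j)
  q∤σ[q^j] zero    = q∤1
  q∤σ[q^j] (suc j) q∣σ = q∤1 (∣m+n∣m⇒∣n q∣q*σ+1 (m∣m*n (σ (q ^ j))))
    where
    q∣q*σ+1 : q ∣ q * σ (q ^ j) + 1
    q∣q*σ+1 = subst (q ∣_) (trans (σ[q^1+j] j) (+-comm 1 _)) q∣σ

  σ[q^j*M]≡σ[q^j]*σ[M] : ∀ {M} .{{_ : NonZero M}} → q ∤ M → ∀ j → σ (q ^ j * M) ≡ σ (q ^ j) * σ M
  σ[q^j*M]≡σ[q^j]*σ[M] {M} q∤M zero    = trans (cong σ (*-identityˡ M)) (sym (*-identityˡ (σ M)))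
  σ[q^j*M]≡σ[q^j]*σ[M] {M} q∤M (suc j) = begin
    σ (q * q ^ j * M)                 ≡⟨ cong σ (*-assoc q (q ^ j) M) ⟩
    σ (q * (q ^ j * M))               ≡⟨ σ[q*q^j*M]≡σ[M]+q*σ[q^j*M] q∤M j ⟩
    σ M + q * σ (q ^ j * M)           ≡⟨ cong (λ x → σ M + q * x) (σ[q^j*M]≡σ[q^j]*σ[M] q∤M j) ⟩
    σ M + q * (σ (q ^ j) * σ M)       ≡⟨ factor (σ M) q (σ (q ^ j)) ⟩
    (1 + q * σ (q ^ j)) * σ M         ≡⟨ cong (_* σ M) (σ[q^1+j] j) ⟨
    σ (q ^ suc j) * σ M               ∎
    where
    factor : ∀ a b c → a + b * (c * a) ≡ (1 + b * c) * a
    factor = solve-∀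

  2∣σ[q^odd] : 2 ∣ suc q → ∀ s → 2 ∣ σ (q ^ suc (s * 2))
  2∣σ[q^odd] 2∣1+q zero    = subst (2 ∣_) (sym (trans (σ[q^1+j] 0) (cong suc (*-identityʳ q)))) 2∣1+q
  2∣σ[q^odd] 2∣1+q (suc s) = subst (2 ∣_) (sym σ-expanded)
    (∣m∣n⇒∣m+n 2∣1+q (∣-trans (2∣σ[q^odd] 2∣1+q s) (∣-trans (n∣m*n q) (n∣m*n q))))
    where
    j = suc (s * 2)
    σ-expanded : σ (q ^ suc (suc j)) ≡ suc q + q * (q * σ (q ^ j))
    σ-expanded = begin
      σ (q ^ suc (suc j))                  ≡⟨ σ[q^1+j] (suc j) ⟩
      1 + q * σ (q ^ suc j)                ≡⟨ cong (λ x → 1 + q * x) (σ[q^1+j] j) ⟩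
      1 + q * (1 + q * σ (q ^ j))          ≡⟨ expand q (σ (q ^ j)) ⟩
      suc q + q * (q * σ (q ^ j))          ∎
      where
      expand : ∀ a b → 1 + a * (1 + a * b) ≡ suc a + a * (a * b)
      expand = solve-∀

  gcd[a,m*q^e]≡m : ∀ e {a m} → q ∤ a → m ∣ a → gcd a (m * q ^ e) ≡ m
  gcd[a,m*q^e]≡m e {a} {m} q∤a m∣a = ∣-antisym
    (∣q^e*n∧q∤⇒∣n e (q∤a ∘ λ q∣g → ∣-trans q∣g (gcd[m,n]∣m a _))
                    (subst (gcd a (m * q ^ e) ∣_) (*-comm m (q ^ e)) (gcd[m,n]∣n a _)))
    (gcd-greatest m∣a (m∣m*n (q ^ e)))

[+m+n]-[+m]≡+n : ∀ m n → + (m + n) ℤ.- + m ≡ + n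
[+m+n]-[+m]≡+n m n = begin
  + (m + n) ℤ.- + m     ≡⟨ ℤ.[+m]-[+n]≡m⊖n (m + n) m ⟩
  (m + n) ℤ.⊖ m         ≡⟨ ℤ.⊖-≥ (m≤m+n m n) ⟩
  + (m + n ∸ m)         ≡⟨ cong +_ (m+n∸m≡n m n) ⟩
  + n                   ∎

module _ {q M : ℕ} .{{_ : NonZero M}} (q-prime : Prime q) (q∤M : q ∤ M) (j : ℕ)
         (2∣σ[q^k] : 2 ∣ σ (q ^ suc j)) (perfect : Perfect (q ^ suc j * M)) where

  private
    k = suc j

    instance
      q^k≢0 : NonZero (q ^ k)
      q^k≢0 = m^n≢0 q k {{prime⇒nonZero q-prime}}

    σ[q^k]*σ[M]≡2*M*q^k : σ (q ^ k) * σ M ≡ 2 * M * q ^ k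
    σ[q^k]*σ[M]≡2*M*q^k = begin
      σ (q ^ k) * σ M     ≡⟨ σ[q^j*M]≡σ[q^j]*σ[M] q-prime q∤M k ⟨
      σ (q ^ k * M)       ≡⟨ perfect ⟩
      2 * (q ^ k * M)     ≡⟨ rearrange (q ^ k) M ⟩
      2 * M * q ^ k       ∎
      where
      rearrange : ∀ a b → 2 * (a * b) ≡ 2 * b * a
      rearrange = solve-∀

    q^k∣σ[M] : q ^ k ∣ σ M
    q^k∣σ[M] = q^e∣m*n∧q∤m⇒q^e∣n q-prime k (q∤σ[q^j] q-prime k) (divides (2 * M) σ[q^k]*σ[M]≡2*M*q^k)

    m = quotient q^k∣σ[M]

    σ[M]≡m*q^k : σ M ≡ m * q ^ k
    σ[M]≡m*q^k = _∣_.equality q^k∣σ[M]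

    σ[q^k]*m≡2*M : σ (q ^ k) * m ≡ 2 * M
    σ[q^k]*m≡2*M = *-cancelʳ-≡ _ _ (q ^ k) (begin
      σ (q ^ k) * m * q ^ k     ≡⟨ *-assoc (σ (q ^ k)) m (q ^ k) ⟩
      σ (q ^ k) * (m * q ^ k)   ≡⟨ cong (σ (q ^ k) *_) σ[M]≡m*q^k ⟨
      σ (q ^ k) * σ M           ≡⟨ σ[q^k]*σ[M]≡2*M*q^k ⟩
      2 * M * q ^ k             ∎)

    m∣M : m ∣ M
    m∣M = *-cancelˡ-∣ 2 (subst (2 * m ∣_) σ[q^k]*m≡2*M (*-monoˡ-∣ m 2∣σ[q^k]))

    gcd[M,σM]≡m : gcd M (σ M) ≡ m
    gcd[M,σM]≡m = trans (cong (gcd M) σ[M]≡m*q^k) (gcd[a,m*q^e]≡m q-prime k q∤M m∣M)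

    σ[M]+gcd[M,σM]*σ[q^j]≡2*M : σ M + gcd M (σ M) * σ (q ^ j) ≡ 2 * M
    σ[M]+gcd[M,σM]*σ[q^j]≡2*M = begin
      σ M + gcd M (σ M) * σ (q ^ j)     ≡⟨ cong₂ (λ x y → x + y * σ (q ^ j)) σ[M]≡m*q^k gcd[M,σM]≡m ⟩
      m * q ^ k + m * σ (q ^ j)         ≡⟨ *-distribˡ-+ m (q ^ k) (σ (q ^ j)) ⟨
      m * (q ^ k + σ (q ^ j))           ≡⟨ cong (m *_) (σ[q^1+j]≡q^1+j+σ[q^j] q-prime j) ⟨
      m * σ (q ^ k)                     ≡⟨ *-comm m (σ (q ^ k)) ⟩
      σ (q ^ k) * m                     ≡⟨ σ[q^k]*m≡2*M ⟩
      2 * M                             ∎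

  gcd[M,σM]*q^k≡σM : gcd M (σ M) * q ^ k ≡ σ M
  gcd[M,σM]*q^k≡σM = trans (cong (_* q ^ k) gcd[M,σM]≡m) (sym σ[M]≡m*q^k)

  +gcd[M,σM]*σ[q^j]≡D[M] : + gcd M (σ M) *ℤ + σ (q ^ j) ≡ D M
  +gcd[M,σM]*σ[q^j]≡D[M] = begin
    + gcd M (σ M) *ℤ + σ (q ^ j)                     ≡⟨ ℤ.pos-* (gcd M (σ M)) (σ (q ^ j)) ⟨
    + (gcd M (σ M) * σ (q ^ j))                      ≡⟨ [+m+n]-[+m]≡+n (σ M) _ ⟨
    + (σ M + gcd M (σ M) * σ (q ^ j)) ℤ.- + σ M      ≡⟨ cong (λ x → + x ℤ.- + σ M) σ[M]+gcd[M,σM]*σ[q^j]≡2*M ⟩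
    D M                                              ∎

≡1-mod-4⇒odd : ∀ m → m % 4 ≡ 1 → m ≡ suc (m / 4 * 2 * 2)
≡1-mod-4⇒odd m m≡1 = begin
  m                      ≡⟨ m≡m%n+[m/n]*n m 4 ⟩
  m % 4 + m / 4 * 4      ≡⟨ cong₂ _+_ m≡1 (sym (*-assoc (m / 4) 2 2)) ⟩
  suc (m / 4 * 2 * 2)    ∎

lemma4 : (N q k n : ℕ) → N > 0 → Odd N → Perfect N → Prime q →
    q % 4 ≡ 1 → k % 4 ≡ 1 → gcd q n ≡ 1 → N ≡ q ^ k * n ^ 2 →
    ⦃ _ : NonZero (q ^ k) ⦄ →
    (+ gcd (n ^ 2) (σ (n ^ 2)) *ℤ + σ (q ^ (k ∸ 1)) ≡ D (n ^ 2))
    × (gcd (n ^ 2) (σ (n ^ 2)) * q ^ k ≡ σ (N / q ^ k))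
lemma4 N q k n N>0 _ perfect q-prime q≡1[4] k≡1[4] gcd[q,n]≡1 refl
  with k / 4 * 2 | ≡1-mod-4⇒odd k k≡1[4]
... | s | refl =
  +gcd[M,σM]*σ[q^j]≡D[M] q-prime q∤M (s * 2) 2∣σ[q^k] perfect ,
  trans (gcd[M,σM]*q^k≡σM q-prime q∤M (s * 2) 2∣σ[q^k] perfect) (cong σ (sym q^k*M/q^k≡M))
  where
  M = n ^ 2
  instance
    M≢0 : NonZero M
    M≢0 = m*n≢0⇒n≢0 (q ^ suc (s * 2)) {{>-nonZero N>0}}
  q∤M : q ∤ M
  q∤M = coprime⇒∤ q-prime (coprime-^ʳ 2 (gcd≡1⇒coprime gcd[q,n]≡1))
  2∣σ[q^k] : 2 ∣ σ (q ^ suc (s * 2))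
  2∣σ[q^k] = 2∣σ[q^odd] q-prime (divides (suc (q / 4 * 2)) (cong suc (≡1-mod-4⇒odd q q≡1[4]))) s
  q^k*M/q^k≡M : q ^ suc (s * 2) * M / q ^ suc (s * 2) ≡ M
  q^k*M/q^k≡M = trans (cong (_/ q ^ suc (s * 2)) (*-comm _ M)) (m*n/n≡m M (q ^ suc (s * 2)))
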